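{- For all integers $n,k$ with $n\equiv 1$ or $3\pmod 4$, $k\equiv 2\pmod 4$ and $n>k\geq 6$, there exists a Heffter array $H(n;k)$.
   Context: A Heffter array $H(n;k)$ is an $n\times n$ array, some of whose cells are filled with integers, such that: each row and each column contains exactly $k$ filled cells; every row sum and column sum is congruent to $0$ modulo $2nk+1$; and for each integer $1\leq x\leq nk$, either $x$ or $-x$ appears in the array. -}

module Defs where

open import Data.Nat using (ℕ; suc; _+_; _*_; _≤_)
open import Data.Integer as ℤ using (ℤ; +_; -_)
open import Data.Integer.Divisibility using () renaming (_∣_ to _∣ℤ_)
open import Data.Fin using (Fin)
open import Data.Maybe using (Maybe; just; nothing)
open import Data.Vec.Functional using (Vector; foldr)
open import Data.Product using (Σ; ∃; _×_; _,_)
open import Data.Sum using (_⊎_)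
open import Relation.Binary.PropositionalEquality using (_≡_)

PartialArray : ℕ → Set
PartialArray n = Fin n → Fin n → Maybe ℤ

filledCount : ∀ {n} → Vector (Maybe ℤ) n → ℕ
filledCount = foldr (λ { (just _) c → suc c ; nothing c → c }) 0

lineSum : ∀ {n} → Vector (Maybe ℤ) n → ℤ
lineSum = foldr (λ { (just x) s → x ℤ.+ s ; nothing s → s }) (+ 0)

row : ∀ {n} → PartialArray n → Fin n → Vector (Maybe ℤ) n
row A i = λ j → A i j

col : ∀ {n} → PartialArray n → Fin n → Vector (Maybe ℤ) n
col A j = λ i → A i j

record IsHeffter (n k : ℕ) (A : PartialArray n) : Set where
  field
    rowCount : ∀ i → filledCount (row A i) ≡ k
    colCount : ∀ j → filledCount (col A j) ≡ k
    rowSum   : ∀ i → (+ (2 * n * k + 1)) ∣ℤ lineSum (row A i)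
    colSum   : ∀ j → (+ (2 * n * k + 1)) ∣ℤ lineSum (col A j)
    support  : ∀ (x : ℕ) → 1 ≤ x → x ≤ n * k →
               ∃ λ i → ∃ λ j → (A i j ≡ just (+ x)) ⊎ (A i j ≡ just (- (+ x)))

HeffterArray : ℕ → ℕ → Set
HeffterArray n k = Σ (PartialArray n) (IsHeffter n k)

module Submission where

-- The array is cyclic: cell (i, j) lies on the diagonal d = (j − i) mod n, and every row
-- and every column meets each diagonal exactly once.  Of the n diagonals, k = 4q + 6 are
-- filled; in row i a filled diagonal d holds ±(1 + ρ + dn) with phase ρ = (i + γ_d) mod n,
-- so it covers the d-th block of n consecutive absolute values (the block k − 1 is placed,
-- reversed, on diagonal k, and diagonal k − 1 stays empty).  A line sum thus splits into
-- the signed sum of the block offsets, the same for every line and equal to −(2nk + 1),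
-- and a signed sum of phases.  The latter vanishes because the filled diagonals pair off
-- with opposite signs and equal phases: along a row the phase depends only on γ_d, along
-- a column only on γ_d − d, and the signs and shifts of each block of four diagonals
-- (+0, −0, −2, +2) and of the final seven (+0, −0, +1, −1, −4, empty, +4) admit both
-- pairings.

open import Defs
open import Data.Nat as ℕ using (ℕ; zero; suc; _∸_; _<_; _≤_; _%_; _/_; NonZero; z≤n; s≤s)
import Data.Nat.Properties as ℕ
open import Data.Nat.DivMod
import Data.Nat.Tactic.RingSolver as ℕ-Solver
open import Data.Integer using (ℤ; +_; -_; 0ℤ; 1ℤ; -1ℤ; _+_; _*_; _-_)
open import Data.Integer.Properties
  using (+-identityˡ; +-identityʳ; +-assoc; +-comm; *-identityˡ; *-zeroˡ; *-zeroʳ; *-distribʳ-+;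
         +-injective; pos-+; pos-*; +-0-abelianGroup; +-commutativeSemigroup)
open import Data.Integer.Tactic.RingSolver using (solve-∀)
open import Data.Integer.Divisibility using () renaming (_∣_ to _∣ℤ_)
open import Data.Integer.Divisibility.Signed using (∣⇒∣ᵤ; ∣m⇒∣-m; ∣-refl)
open import Algebra.Properties.AbelianGroup +-0-abelianGroup using (∙-cancelʳ)
open import Algebra.Properties.CommutativeSemigroup +-commutativeSemigroup using (interchange)
open import Data.Fin using (Fin; toℕ; fromℕ<)
open import Data.Fin.Properties using (toℕ<n; toℕ-fromℕ<)
open import Data.Maybe as Maybe using (Maybe; just; nothing; fromMaybe)
open import Data.Product using (∃; _×_; _,_)
open import Data.Sum as Sum using (_⊎_; inj₁; inj₂)
open import Function using (_∘_)
open import Relation.Binary.PropositionalEquality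
open import Relation.Nullary using (yes; no; contradiction)

∑ : ℕ → (ℕ → ℤ) → ℤ
∑ zero    f = 0ℤ
∑ (suc m) f = f 0 + ∑ m (f ∘ suc)

∑-cong : ∀ m {f g : ℕ → ℤ} → (∀ x → x < m → f x ≡ g x) → ∑ m f ≡ ∑ m g
∑-cong zero    eq = refl
∑-cong (suc m) eq = cong₂ _+_ (eq 0 (s≤s z≤n)) (∑-cong m (λ x x<m → eq (suc x) (s≤s x<m)))

∑-+ : ∀ m l (f : ℕ → ℤ) → ∑ (m ℕ.+ l) f ≡ ∑ m f + ∑ l (λ x → f (m ℕ.+ x))
∑-+ zero    l f = sym (+-identityˡ _)
∑-+ (suc m) l f = trans (cong (_+_ (f 0)) (∑-+ m l (f ∘ suc))) (sym (+-assoc (f 0) _ _))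

∑-suc : ∀ m (f : ℕ → ℤ) → ∑ (suc m) f ≡ ∑ m f + f m
∑-suc zero    f = trans (+-identityʳ (f 0)) (sym (+-identityˡ (f 0)))
∑-suc (suc m) f = trans (cong (_+_ (f 0)) (∑-suc m (f ∘ suc))) (sym (+-assoc (f 0) _ _))

∑-distrib : ∀ m (f g : ℕ → ℤ) → ∑ m (λ x → f x + g x) ≡ ∑ m f + ∑ m g
∑-distrib zero    f g = refl
∑-distrib (suc m) f g = trans (cong (_+_ (f 0 + g 0)) (∑-distrib m (f ∘ suc) (g ∘ suc)))
                              (interchange (f 0) (g 0) _ _)

∑-const : ∀ m c → ∑ m (λ _ → c) ≡ + m * c
∑-const zero    c = sym (*-zeroˡ c)
∑-const (suc m) c = begin
  c + ∑ m (λ _ → c)  ≡⟨ cong₂ _+_ (sym (*-identityˡ c)) (∑-const m c) ⟩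
  + 1 * c + + m * c  ≡⟨ *-distribʳ-+ c (+ 1) (+ m) ⟨
  + suc m * c        ∎
  where open ≡-Reasoning

∑-zero : ∀ m {f : ℕ → ℤ} → (∀ x → x < m → f x ≡ 0ℤ) → ∑ m f ≡ 0ℤ
∑-zero m f≡0 = trans (∑-cong m f≡0) (trans (∑-const m 0ℤ) (*-zeroʳ (+ m)))

∑-rotate : ∀ m s (f : ℕ → ℤ) → (∀ x → f (m ℕ.+ x) ≡ f x) → ∑ m (λ x → f (x ℕ.+ s)) ≡ ∑ m f
∑-rotate m zero    f periodic = ∑-cong m (λ x _ → cong f (ℕ.+-identityʳ x))
∑-rotate m (suc s) f periodic = begin
  ∑ m (λ x → f (x ℕ.+ suc s))  ≡⟨ ∑-cong m (λ x _ → cong f (ℕ.+-suc x s)) ⟩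
  ∑ m (g ∘ suc)                ≡⟨ rotate-by-one ⟩
  ∑ m g                        ≡⟨ ∑-rotate m s f periodic ⟩
  ∑ m f                        ∎
  where
  open ≡-Reasoning
  g : ℕ → ℤ
  g x = f (x ℕ.+ s)
  rotate-by-one : ∑ m (g ∘ suc) ≡ ∑ m g
  rotate-by-one = ∙-cancelʳ (g 0) _ _ (begin
    ∑ m (g ∘ suc) + g 0  ≡⟨ +-comm _ (g 0) ⟩
    ∑ (suc m) g          ≡⟨ ∑-suc m g ⟩
    ∑ m g + g m          ≡⟨ cong (_+_ (∑ m g)) (periodic s) ⟩
    ∑ m g + g 0          ∎)

∑-reverse : ∀ m (f : ℕ → ℤ) → ∑ m f ≡ ∑ m (λ x → f (m ∸ suc x))
∑-reverse zero    f = refl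
∑-reverse (suc m) f = begin
  ∑ (suc m) f                          ≡⟨ ∑-suc m f ⟩
  ∑ m f + f m                          ≡⟨ cong (_+ f m) (∑-reverse m f) ⟩
  ∑ m (λ x → f (m ∸ suc x)) + f m      ≡⟨ +-comm _ (f m) ⟩
  ∑ (suc m) (λ x → f (suc m ∸ suc x))  ∎
  where open ≡-Reasoning

module Modular (n : ℕ) .{{_ : NonZero n}} where

  infixl 6 _⊕_ _⊖_

  _⊕_ : ℕ → ℕ → ℕ
  x ⊕ y = (x ℕ.+ y) % n

  -- Subtraction modulo n; it is only meaningful when y ≤ n + x.
  _⊖_ : ℕ → ℕ → ℕ
  x ⊖ y = (n ℕ.+ x ∸ y) % n

  [n+m]%n≡m%n : ∀ m → (n ℕ.+ m) % n ≡ m % n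
  [n+m]%n≡m%n m = trans (cong (_% n) (ℕ.+-comm n m)) ([m+n]%n≡m%n m n)

  [m%n+k]%n≡[m+k]%n : ∀ m k → (m % n ℕ.+ k) % n ≡ (m ℕ.+ k) % n
  [m%n+k]%n≡[m+k]%n m k = begin
    (m % n ℕ.+ k) % n          ≡⟨ %-distribˡ-+ (m % n) k n ⟩
    (m % n % n ℕ.+ k % n) % n  ≡⟨ cong (λ z → (z ℕ.+ k % n) % n) (m%n%n≡m%n m n) ⟩
    (m % n ℕ.+ k % n) % n      ≡⟨ %-distribˡ-+ m k n ⟨
    (m ℕ.+ k) % n              ∎
    where open ≡-Reasoning

  x⊕[y%n]≡x⊕y : ∀ x y → x ⊕ (y % n) ≡ x ⊕ y
  x⊕[y%n]≡x⊕y x y = begin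
    (x ℕ.+ y % n) % n  ≡⟨ cong (_% n) (ℕ.+-comm x (y % n)) ⟩
    (y % n ℕ.+ x) % n  ≡⟨ [m%n+k]%n≡[m+k]%n y x ⟩
    (y ℕ.+ x) % n      ≡⟨ cong (_% n) (ℕ.+-comm y x) ⟩
    (x ℕ.+ y) % n      ∎
    where open ≡-Reasoning

  m+[n∸m%n]≡[1+m/n]*n : ∀ m → m ℕ.+ (n ∸ m % n) ≡ suc (m / n) ℕ.* n
  m+[n∸m%n]≡[1+m/n]*n m = begin
    m ℕ.+ (n ∸ m % n)                        ≡⟨ cong (ℕ._+ (n ∸ m % n)) (m≡m%n+[m/n]*n m n) ⟩
    m % n ℕ.+ m / n ℕ.* n ℕ.+ (n ∸ m % n)    ≡⟨ regroup (m % n) (m / n ℕ.* n) (n ∸ m % n) ⟩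
    m / n ℕ.* n ℕ.+ (m % n ℕ.+ (n ∸ m % n))  ≡⟨ cong (m / n ℕ.* n ℕ.+_) (ℕ.m+[n∸m]≡n (m%n≤n m n)) ⟩
    m / n ℕ.* n ℕ.+ n                        ≡⟨ ℕ.+-comm (m / n ℕ.* n) n ⟩
    suc (m / n) ℕ.* n                        ∎
    where
    open ≡-Reasoning
    regroup : ∀ a b c → a ℕ.+ b ℕ.+ c ≡ b ℕ.+ (a ℕ.+ c)
    regroup = ℕ-Solver.solve-∀

  %-cancelʳ-+ : ∀ a b c → (a ℕ.+ c) % n ≡ (b ℕ.+ c) % n → a % n ≡ b % n
  %-cancelʳ-+ a b c eq = begin
    a % n                          ≡⟨ [m+kn]%n≡m%n a (suc (c / n)) n ⟨
    (a ℕ.+ suc (c / n) ℕ.* n) % n  ≡⟨ cong (λ z → (a ℕ.+ z) % n) (m+[n∸m%n]≡[1+m/n]*n c) ⟨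
    (a ℕ.+ (c ℕ.+ c′)) % n         ≡⟨ cong (_% n) (ℕ.+-assoc a c c′) ⟨
    (a ℕ.+ c ℕ.+ c′) % n           ≡⟨ [m%n+k]%n≡[m+k]%n (a ℕ.+ c) c′ ⟨
    ((a ℕ.+ c) % n ℕ.+ c′) % n     ≡⟨ cong (λ z → (z ℕ.+ c′) % n) eq ⟩
    ((b ℕ.+ c) % n ℕ.+ c′) % n     ≡⟨ [m%n+k]%n≡[m+k]%n (b ℕ.+ c) c′ ⟩
    (b ℕ.+ c ℕ.+ c′) % n           ≡⟨ cong (_% n) (ℕ.+-assoc b c c′) ⟩
    (b ℕ.+ (c ℕ.+ c′)) % n         ≡⟨ cong (λ z → (b ℕ.+ z) % n) (m+[n∸m%n]≡[1+m/n]*n c) ⟩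
    (b ℕ.+ suc (c / n) ℕ.* n) % n  ≡⟨ [m+kn]%n≡m%n b (suc (c / n)) n ⟩
    b % n                          ∎
    where
    open ≡-Reasoning
    c′ = n ∸ c % n

  [n+m∸k+k]%n≡m%n : ∀ m {k} → k ≤ n → (n ℕ.+ m ∸ k ℕ.+ k) % n ≡ m % n
  [n+m∸k+k]%n≡m%n m k≤n =
    trans (cong (_% n) (ℕ.m∸n+n≡m (ℕ.≤-trans k≤n (ℕ.m≤m+n n m)))) ([n+m]%n≡m%n m)

  [x⊕y]⊖y≡x : ∀ {x y} → x < n → y ≤ n → (x ⊕ y) ⊖ y ≡ x
  [x⊕y]⊖y≡x {x} {y} x<n y≤n = trans (%-cancelʳ-+ (n ℕ.+ (x ⊕ y) ∸ y) x y (begin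
    (n ℕ.+ (x ⊕ y) ∸ y ℕ.+ y) % n  ≡⟨ [n+m∸k+k]%n≡m%n (x ⊕ y) y≤n ⟩
    (x ℕ.+ y) % n % n              ≡⟨ m%n%n≡m%n (x ℕ.+ y) n ⟩
    (x ℕ.+ y) % n                  ∎)) (m<n⇒m%n≡m x<n)
    where open ≡-Reasoning

  [x⊖y]⊕y≡x : ∀ {x y} → x < n → y ≤ n → (x ⊖ y) ⊕ y ≡ x
  [x⊖y]⊕y≡x {x} {y} x<n y≤n = begin
    ((n ℕ.+ x ∸ y) % n ℕ.+ y) % n  ≡⟨ [m%n+k]%n≡[m+k]%n (n ℕ.+ x ∸ y) y ⟩
    (n ℕ.+ x ∸ y ℕ.+ y) % n        ≡⟨ [n+m∸k+k]%n≡m%n x y≤n ⟩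
    x % n                          ≡⟨ m<n⇒m%n≡m x<n ⟩
    x                              ∎
    where open ≡-Reasoning

  x⊖[x⊖y]≡y : ∀ {x y} → y < n → x ⊖ (x ⊖ y) ≡ y
  x⊖[x⊖y]≡y {x} {y} y<n = trans (%-cancelʳ-+ (n ℕ.+ x ∸ (x ⊖ y)) y (x ⊖ y) (begin
    (n ℕ.+ x ∸ (x ⊖ y) ℕ.+ (x ⊖ y)) % n  ≡⟨ [n+m∸k+k]%n≡m%n x (m%n≤n (n ℕ.+ x ∸ y) n) ⟩
    x % n                                ≡⟨ [n+m∸k+k]%n≡m%n x (ℕ.<⇒≤ y<n) ⟨
    (n ℕ.+ x ∸ y ℕ.+ y) % n              ≡⟨ cong (_% n) (ℕ.+-comm (n ℕ.+ x ∸ y) y) ⟩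
    (y ℕ.+ (n ℕ.+ x ∸ y)) % n            ≡⟨ x⊕[y%n]≡x⊕y y (n ℕ.+ x ∸ y) ⟨
    (y ℕ.+ (x ⊖ y)) % n                  ∎)) (m<n⇒m%n≡m y<n)
    where open ≡-Reasoning

  [x⊖d₁]⊕γ₁≡[x⊖d₂]⊕γ₂ : ∀ x {d₁ d₂ γ₁ γ₂} → d₁ ≤ n → d₂ ≤ n → d₁ ℕ.+ γ₂ ≡ d₂ ℕ.+ γ₁ →
                        (x ⊖ d₁) ⊕ γ₁ ≡ (x ⊖ d₂) ⊕ γ₂
  [x⊖d₁]⊕γ₁≡[x⊖d₂]⊕γ₂ x {d₁} {d₂} {γ₁} {γ₂} d₁≤n d₂≤n eq = begin
    (x ⊖ d₁) ⊕ γ₁                                ≡⟨ [m%n+k]%n≡[m+k]%n (n ℕ.+ x ∸ d₁) γ₁ ⟩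
    (n ℕ.+ x ∸ d₁ ℕ.+ γ₁) % n                    ≡⟨ %-cancelʳ-+ _ _ (d₁ ℕ.+ γ₂) (begin
      (n ℕ.+ x ∸ d₁ ℕ.+ γ₁ ℕ.+ (d₁ ℕ.+ γ₂)) % n  ≡⟨ cong (_% n) (cancel-∸ d₁≤n) ⟩
      (n ℕ.+ x ℕ.+ (γ₁ ℕ.+ γ₂)) % n              ≡⟨ cong (λ z → (n ℕ.+ x ℕ.+ z) % n) (ℕ.+-comm γ₁ γ₂) ⟩
      (n ℕ.+ x ℕ.+ (γ₂ ℕ.+ γ₁)) % n              ≡⟨ cong (_% n) (cancel-∸ d₂≤n) ⟨
      (n ℕ.+ x ∸ d₂ ℕ.+ γ₂ ℕ.+ (d₂ ℕ.+ γ₁)) % n  ≡⟨ cong (λ z → (n ℕ.+ x ∸ d₂ ℕ.+ γ₂ ℕ.+ z) % n) eq ⟨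
      (n ℕ.+ x ∸ d₂ ℕ.+ γ₂ ℕ.+ (d₁ ℕ.+ γ₂)) % n  ∎) ⟩
    (n ℕ.+ x ∸ d₂ ℕ.+ γ₂) % n  ≡⟨ [m%n+k]%n≡[m+k]%n (n ℕ.+ x ∸ d₂) γ₂ ⟨
    (x ⊖ d₂) ⊕ γ₂              ∎
    where
    open ≡-Reasoning
    cancel-∸ : ∀ {d γ γ′} → d ≤ n → n ℕ.+ x ∸ d ℕ.+ γ ℕ.+ (d ℕ.+ γ′) ≡ n ℕ.+ x ℕ.+ (γ ℕ.+ γ′)
    cancel-∸ {d} {γ} {γ′} d≤n = begin
      n ℕ.+ x ∸ d ℕ.+ γ ℕ.+ (d ℕ.+ γ′)  ≡⟨ shuffle (n ℕ.+ x ∸ d) γ d γ′ ⟩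
      n ℕ.+ x ∸ d ℕ.+ d ℕ.+ (γ ℕ.+ γ′)
        ≡⟨ cong (ℕ._+ (γ ℕ.+ γ′)) (ℕ.m∸n+n≡m (ℕ.≤-trans d≤n (ℕ.m≤m+n n x))) ⟩
      n ℕ.+ x ℕ.+ (γ ℕ.+ γ′)            ∎
      where
      shuffle : ∀ a b c e → a ℕ.+ b ℕ.+ (c ℕ.+ e) ≡ a ℕ.+ c ℕ.+ (b ℕ.+ e)
      shuffle = ℕ-Solver.solve-∀

  ∑-⊕ : ∀ s (f : ℕ → ℤ) → ∑ n (λ x → f (x ⊕ s)) ≡ ∑ n f
  ∑-⊕ s f = begin
    ∑ n (λ x → f (x ⊕ s))  ≡⟨ ∑-rotate n s (f ∘ (_% n)) (cong f ∘ [n+m]%n≡m%n) ⟩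
    ∑ n (f ∘ (_% n))       ≡⟨ ∑-cong n (λ x x<n → cong f (m<n⇒m%n≡m x<n)) ⟩
    ∑ n f                  ∎
    where open ≡-Reasoning

  ∑-⊖ʳ : ∀ {i} → i ≤ n → (f : ℕ → ℤ) → ∑ n (λ x → f (x ⊖ i)) ≡ ∑ n f
  ∑-⊖ʳ {i} i≤n f = begin
    ∑ n (λ x → f (x ⊖ i))        ≡⟨ ∑-⊕ i (λ x → f (x ⊖ i)) ⟨
    ∑ n (λ x → f ((x ⊕ i) ⊖ i))  ≡⟨ ∑-cong n (λ x x<n → cong f ([x⊕y]⊖y≡x x<n i≤n)) ⟩
    ∑ n f                        ∎
    where open ≡-Reasoning

  ∑-⊖ˡ : ∀ j (f : ℕ → ℤ) → ∑ n (λ x → f (j ⊖ x)) ≡ ∑ n f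
  ∑-⊖ˡ j f = begin
    ∑ n (λ x → f (j ⊖ x))            ≡⟨ ∑-reverse n (λ x → f (j ⊖ x)) ⟩
    ∑ n (λ x → f (j ⊖ (n ∸ suc x)))  ≡⟨ ∑-cong n (λ x x<n → cong (λ z → f (z % n)) (reflect x<n)) ⟩
    ∑ n (λ x → f (x ⊕ suc j))        ≡⟨ ∑-⊕ (suc j) f ⟩
    ∑ n f                            ∎
    where
    open ≡-Reasoning
    reflect : ∀ {x} → x < n → n ℕ.+ j ∸ (n ∸ suc x) ≡ x ℕ.+ suc j
    reflect {x} x<n = begin
      n ℕ.+ j ∸ (n ∸ suc x)  ≡⟨ ℕ.+-∸-comm j (ℕ.m∸n≤m n (suc x)) ⟩
      n ∸ (n ∸ suc x) ℕ.+ j  ≡⟨ cong (ℕ._+ j) (ℕ.m∸[m∸n]≡n x<n) ⟩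
      suc x ℕ.+ j            ≡⟨ ℕ.+-suc x j ⟨
      x ℕ.+ suc j            ∎

indicator : ∀ {A : Set} → Maybe A → ℤ
indicator (just _) = 1ℤ
indicator nothing  = 0ℤ

lineSum≡∑ : ∀ m (h : ℕ → Maybe ℤ) → lineSum {m} (h ∘ toℕ) ≡ ∑ m (fromMaybe 0ℤ ∘ h)
lineSum≡∑ zero    h = refl
lineSum≡∑ (suc m) h with h 0 | lineSum≡∑ m (h ∘ suc)
... | just x  | eq = cong (_+_ x) eq
... | nothing | eq = trans eq (sym (+-identityˡ _))

filledCount≡∑ : ∀ m (h : ℕ → Maybe ℤ) → + filledCount {m} (h ∘ toℕ) ≡ ∑ m (indicator ∘ h)
filledCount≡∑ zero    h = refl
filledCount≡∑ (suc m) h with h 0 | filledCount≡∑ m (h ∘ suc)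
... | just _  | eq = cong (_+_ 1ℤ) eq
... | nothing | eq = trans eq (sym (+-identityˡ _))

∣-negation : ∀ {i j} → j ≡ - i → i ∣ℤ j
∣-negation {i} refl = ∣⇒∣ᵤ (∣m⇒∣-m (∣-refl {i}))

record Diagonal : Set where
  constructor diagonal
  field
    sign   : ℤ
    shift  : ℕ
    offset : ℤ

open Diagonal

_≡±_ : ℤ → ℕ → Set
v ≡± x = v ≡ + x ⊎ v ≡ - + x

module CyclicArray (n : ℕ) .{{_ : NonZero n}} (D : ℕ → Maybe Diagonal) where
  open Modular n

  value : Diagonal → ℕ → ℤ
  value δ ρ = sign δ * + ρ + offset δ

  cell : Maybe Diagonal → ℕ → Maybe ℤ
  cell m r = Maybe.map (λ δ → value δ (r ⊕ shift δ)) m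

  array : PartialArray n
  array i j = cell (D (toℕ j ⊖ toℕ i)) (toℕ i)

  phaseTerm : Maybe Diagonal → ℕ → ℤ
  phaseTerm (just δ) r = sign δ * + (r ⊕ shift δ)
  phaseTerm nothing  r = 0ℤ

  offsetTerm : Maybe Diagonal → ℤ
  offsetTerm = Maybe.maybe offset 0ℤ

  cell-value : ∀ m r → fromMaybe 0ℤ (cell m r) ≡ phaseTerm m r + offsetTerm m
  cell-value (just δ) r = refl
  cell-value nothing  r = refl

  cell-indicator : ∀ m r → indicator (cell m r) ≡ indicator m
  cell-indicator (just δ) r = refl
  cell-indicator nothing  r = refl

  ∑-row : ∀ (w : Maybe ℤ → ℤ) (i : Fin n) →
          ∑ n (λ j → w (cell (D (j ⊖ toℕ i)) (toℕ i))) ≡ ∑ n (λ d → w (cell (D d) (toℕ i)))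
  ∑-row w i = ∑-⊖ʳ (ℕ.<⇒≤ (toℕ<n i)) (λ d → w (cell (D d) (toℕ i)))

  ∑-col : ∀ (w : Maybe ℤ → ℤ) (j : Fin n) →
          ∑ n (λ i → w (cell (D (toℕ j ⊖ i)) i)) ≡ ∑ n (λ d → w (cell (D d) (toℕ j ⊖ d)))
  ∑-col w j = begin
    ∑ n (λ i → w (cell (D (toℕ j ⊖ i)) i))
      ≡⟨ ∑-cong n (λ i i<n → cong (w ∘ cell (D (toℕ j ⊖ i))) (x⊖[x⊖y]≡y i<n)) ⟨
    ∑ n (λ i → w (cell (D (toℕ j ⊖ i)) (toℕ j ⊖ (toℕ j ⊖ i))))
      ≡⟨ ∑-⊖ˡ (toℕ j) (λ d → w (cell (D d) (toℕ j ⊖ d))) ⟩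
    ∑ n (λ d → w (cell (D d) (toℕ j ⊖ d)))
      ∎
    where open ≡-Reasoning

  filledCount-row : ∀ i → + filledCount (row array i) ≡ ∑ n (indicator ∘ D)
  filledCount-row i = begin
    + filledCount (row array i)                           ≡⟨ filledCount≡∑ n (λ j → cell (D (j ⊖ toℕ i)) (toℕ i)) ⟩
    ∑ n (λ j → indicator (cell (D (j ⊖ toℕ i)) (toℕ i)))  ≡⟨ ∑-row indicator i ⟩
    ∑ n (λ d → indicator (cell (D d) (toℕ i)))            ≡⟨ ∑-cong n (λ d _ → cell-indicator (D d) (toℕ i)) ⟩
    ∑ n (indicator ∘ D)                                   ∎
    where open ≡-Reasoning

  filledCount-col : ∀ j → + filledCount (col array j) ≡ ∑ n (indicator ∘ D)
  filledCount-col j = begin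
    + filledCount (col array j)                     ≡⟨ filledCount≡∑ n (λ i → cell (D (toℕ j ⊖ i)) i) ⟩
    ∑ n (λ i → indicator (cell (D (toℕ j ⊖ i)) i))  ≡⟨ ∑-col indicator j ⟩
    ∑ n (λ d → indicator (cell (D d) (toℕ j ⊖ d)))  ≡⟨ ∑-cong n (λ d _ → cell-indicator (D d) (toℕ j ⊖ d)) ⟩
    ∑ n (indicator ∘ D)                             ∎
    where open ≡-Reasoning

  lineSum-split : ∀ (phase : ℕ → ℕ) →
    ∑ n (λ d → fromMaybe 0ℤ (cell (D d) (phase d))) ≡
    ∑ n (λ d → phaseTerm (D d) (phase d)) + ∑ n (offsetTerm ∘ D)
  lineSum-split phase = trans (∑-cong n (λ d _ → cell-value (D d) (phase d))) (∑-distrib n _ _)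

  lineSum-row : ∀ i →
    lineSum (row array i) ≡ ∑ n (λ d → phaseTerm (D d) (toℕ i)) + ∑ n (offsetTerm ∘ D)
  lineSum-row i = begin
    lineSum (row array i)                                       ≡⟨ lineSum≡∑ n (λ j → cell (D (j ⊖ toℕ i)) (toℕ i)) ⟩
    ∑ n (λ j → fromMaybe 0ℤ (cell (D (j ⊖ toℕ i)) (toℕ i)))     ≡⟨ ∑-row (fromMaybe 0ℤ) i ⟩
    ∑ n (λ d → fromMaybe 0ℤ (cell (D d) (toℕ i)))               ≡⟨ lineSum-split (λ _ → toℕ i) ⟩
    ∑ n (λ d → phaseTerm (D d) (toℕ i)) + ∑ n (offsetTerm ∘ D)  ∎
    where open ≡-Reasoning

  lineSum-col : ∀ j →
    lineSum (col array j) ≡ ∑ n (λ d → phaseTerm (D d) (toℕ j ⊖ d)) + ∑ n (offsetTerm ∘ D)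
  lineSum-col j = begin
    lineSum (col array j)                                           ≡⟨ lineSum≡∑ n (λ i → cell (D (toℕ j ⊖ i)) i) ⟩
    ∑ n (λ i → fromMaybe 0ℤ (cell (D (toℕ j ⊖ i)) i))               ≡⟨ ∑-col (fromMaybe 0ℤ) j ⟩
    ∑ n (λ d → fromMaybe 0ℤ (cell (D d) (toℕ j ⊖ d)))               ≡⟨ lineSum-split (toℕ j ⊖_) ⟩
    ∑ n (λ d → phaseTerm (D d) (toℕ j ⊖ d)) + ∑ n (offsetTerm ∘ D)  ∎
    where open ≡-Reasoning

  cell-at-phase : ∀ {d ρ δ} → d < n → ρ < n → D d ≡ just δ →
                  ∃ λ i → ∃ λ j → array i j ≡ just (value δ ρ)
  cell-at-phase {d} {ρ} {δ} d<n ρ<n Dd≡δ = fromℕ< i<n , fromℕ< j<n , (begin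
    cell (D (toℕ (fromℕ< j<n) ⊖ toℕ (fromℕ< i<n))) (toℕ (fromℕ< i<n))
      ≡⟨ cong₂ (λ a b → cell (D (a ⊖ b)) b) (toℕ-fromℕ< j<n) (toℕ-fromℕ< i<n) ⟩
    cell (D ((d ⊕ i) ⊖ i)) i
      ≡⟨ cong (λ e → cell (D e) i) ([x⊕y]⊖y≡x d<n (ℕ.<⇒≤ i<n)) ⟩
    cell (D d) i
      ≡⟨ cong (λ m → cell m i) Dd≡δ ⟩
    just (value δ (i ⊕ shift δ))
      ≡⟨ cong (just ∘ value δ) (x⊕[y%n]≡x⊕y i (shift δ)) ⟨
    just (value δ (i ⊕ (shift δ % n)))
      ≡⟨ cong (just ∘ value δ) ([x⊖y]⊕y≡x ρ<n (m%n≤n (shift δ) n)) ⟩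
    just (value δ ρ)
      ∎)
    where
    open ≡-Reasoning
    i = ρ ⊖ (shift δ % n)
    i<n : i < n
    i<n = m%n<n _ n
    j<n : d ⊕ i < n
    j<n = m%n<n _ n

  Occurs : ℕ → Set
  Occurs x = ∃ λ d → ∃ λ ρ → ∃ λ δ → d < n × ρ < n × D d ≡ just δ × value δ ρ ≡± x

  isHeffter : ∀ k →
    ∑ n (indicator ∘ D) ≡ + k →
    (∀ i → ∑ n (λ d → phaseTerm (D d) i) ≡ 0ℤ) →
    (∀ j → ∑ n (λ d → phaseTerm (D d) (j ⊖ d)) ≡ 0ℤ) →
    + (2 ℕ.* n ℕ.* k ℕ.+ 1) ∣ℤ ∑ n (offsetTerm ∘ D) →
    (∀ x → 1 ≤ x → x ≤ n ℕ.* k → Occurs x) →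
    IsHeffter n k array
  isHeffter k count rowPhases colPhases offsets occurs = record
    { rowCount = λ i → +-injective (trans (filledCount-row i) count)
    ; colCount = λ j → +-injective (trans (filledCount-col j) count)
    ; rowSum   = λ i → offsets-divide (lineSum-row i) (rowPhases (toℕ i))
    ; colSum   = λ j → offsets-divide (lineSum-col j) (colPhases (toℕ j))
    ; support  = λ x 1≤x x≤nk → filled (occurs x 1≤x x≤nk)
    }
    where
    offsets-divide : ∀ {s p} → s ≡ p + ∑ n (offsetTerm ∘ D) → p ≡ 0ℤ → + (2 ℕ.* n ℕ.* k ℕ.+ 1) ∣ℤ s
    offsets-divide s≡ refl =
      subst (+ (2 ℕ.* n ℕ.* k ℕ.+ 1) ∣ℤ_) (sym (trans s≡ (+-identityˡ (∑ n (offsetTerm ∘ D))))) offsets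
    filled : ∀ {x} → Occurs x → ∃ λ i → ∃ λ j → array i j ≡ just (+ x) ⊎ array i j ≡ just (- + x)
    filled (d , ρ , δ , d<n , ρ<n , Dd≡δ , ±x) with cell-at-phase d<n ρ<n Dd≡δ
    ... | i , j , eq = i , j , Sum.map (trans eq ∘ cong just) (trans eq ∘ cong just) ±x

data Kind : Set where
  pos neg dec : Kind

block : ℕ → Maybe (Kind × ℕ)
block 0 = just (pos , 0)
block 1 = just (neg , 0)
block 2 = just (neg , 2)
block 3 = just (pos , 2)
block _ = nothing

final : ℕ → Maybe (Kind × ℕ)
final 0 = just (pos , 0)
final 1 = just (neg , 0)
final 2 = just (pos , 1)
final 3 = just (neg , 1)
final 4 = just (neg , 4)
final 6 = just (dec , 4)
final _ = nothing

layout : ℕ → ℕ → Maybe (Kind × ℕ)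
layout zero    d                         = final d
layout (suc q) (suc (suc (suc (suc d)))) = layout q d
layout (suc q) r                         = block r

layout-beyond : ∀ q e → layout q (q ℕ.* 4 ℕ.+ 7 ℕ.+ e) ≡ nothing
layout-beyond zero    e = refl
layout-beyond (suc q) e = layout-beyond q e

layout-dec : ∀ q → layout q (suc (q ℕ.* 4 ℕ.+ 5)) ≡ just (dec , 4)
layout-dec zero    = refl
layout-dec (suc q) = layout-dec q

data Signed : Maybe (Kind × ℕ) → Set where
  positive : ∀ γ → Signed (just (pos , γ))
  negative : ∀ γ → Signed (just (neg , γ))

layout-signed : ∀ q c → c < q ℕ.* 4 ℕ.+ 5 → Signed (layout q c)
layout-signed zero    0 _ = positive 0
layout-signed zero    1 _ = negative 0
layout-signed zero    2 _ = positive 1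
layout-signed zero    3 _ = negative 1
layout-signed zero    4 _ = negative 4
layout-signed zero    (suc (suc (suc (suc (suc c))))) (s≤s (s≤s (s≤s (s≤s (s≤s ())))))
layout-signed (suc q) 0 _ = positive 0
layout-signed (suc q) 1 _ = negative 0
layout-signed (suc q) 2 _ = negative 2
layout-signed (suc q) 3 _ = positive 2
layout-signed (suc q) (suc (suc (suc (suc c)))) (s≤s (s≤s (s≤s (s≤s c<)))) = layout-signed q c c<

∑-layout : ∀ q (F : ℕ → Maybe (Kind × ℕ) → ℤ) →
  ∑ (q ℕ.* 4 ℕ.+ 7) (λ d → F d (layout q d)) ≡
  ∑ q (λ t → ∑ 4 (λ r → F (t ℕ.* 4 ℕ.+ r) (block r))) + ∑ 7 (λ e → F (q ℕ.* 4 ℕ.+ e) (final e))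
∑-layout zero    F = sym (+-identityˡ _)
∑-layout (suc q) F = begin
  ∑ (4 ℕ.+ (q ℕ.* 4 ℕ.+ 7)) (λ d → F d (layout (suc q) d))
    ≡⟨ ∑-+ 4 (q ℕ.* 4 ℕ.+ 7) (λ d → F d (layout (suc q) d)) ⟩
  first + ∑ (q ℕ.* 4 ℕ.+ 7) (λ d → F (4 ℕ.+ d) (layout q d))
    ≡⟨ cong (_+_ first) (∑-layout q (F ∘ (4 ℕ.+_))) ⟩
  first + (∑ q (λ t → ∑ 4 (λ r → F (4 ℕ.+ (t ℕ.* 4 ℕ.+ r)) (block r))) + last)
    ≡⟨ +-assoc first _ last ⟨
  ∑ (suc q) (λ t → ∑ 4 (λ r → F (t ℕ.* 4 ℕ.+ r) (block r))) + last
    ∎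
  where
  open ≡-Reasoning
  first = ∑ 4 (λ r → F r (block r))
  last  = ∑ 7 (λ e → F (suc q ℕ.* 4 ℕ.+ e) (final e))

module CyclicConstruction (n : ℕ) .{{_ : NonZero n}} (q : ℕ) where
  open Modular n

  layer : ℕ → ℤ
  layer d = + suc (d ℕ.* n)

  layer-+ : ∀ d r → layer (d ℕ.+ r) ≡ 1ℤ + (+ d + + r) * + n
  layer-+ d r = begin
    + suc ((d ℕ.+ r) ℕ.* n)   ≡⟨ pos-+ 1 ((d ℕ.+ r) ℕ.* n) ⟩
    1ℤ + + ((d ℕ.+ r) ℕ.* n)  ≡⟨ cong (_+_ 1ℤ) (pos-* (d ℕ.+ r) n) ⟩
    1ℤ + + (d ℕ.+ r) * + n    ≡⟨ cong (λ z → 1ℤ + z * + n) (pos-+ d r) ⟩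
    1ℤ + (+ d + + r) * + n    ∎
    where open ≡-Reasoning

  realise : ℕ → Kind × ℕ → Diagonal
  realise d (pos , γ) = diagonal 1ℤ  γ (layer d)
  realise d (neg , γ) = diagonal -1ℤ γ (- layer d)
  realise d (dec , γ) = diagonal 1ℤ  γ (1ℤ - layer d)

  diagonals : ℕ → Maybe Diagonal
  diagonals d = Maybe.map (realise d) (layout q d)

  open CyclicArray n diagonals public

  blockSum : (Maybe Diagonal → ℕ → ℤ) → ℕ → ℤ
  blockSum G b = ∑ 4 (λ r → G (Maybe.map (realise (b ℕ.+ r)) (block r)) (b ℕ.+ r))

  finalSum : (Maybe Diagonal → ℕ → ℤ) → ℕ → ℤ
  finalSum G b = ∑ 7 (λ e → G (Maybe.map (realise (b ℕ.+ e)) (final e)) (b ℕ.+ e))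

  ∑-diagonals : ∀ (G : Maybe Diagonal → ℕ → ℤ) → (∀ d → G nothing d ≡ 0ℤ) → q ℕ.* 4 ℕ.+ 7 ≤ n →
    ∑ n (λ d → G (diagonals d) d) ≡ ∑ q (λ t → blockSum G (t ℕ.* 4)) + finalSum G (q ℕ.* 4)
  ∑-diagonals G G-nothing bound = begin
    ∑ n g                                  ≡⟨ cong (λ m → ∑ m g) (ℕ.m+[n∸m]≡n bound) ⟨
    ∑ (K ℕ.+ (n ∸ K)) g                    ≡⟨ ∑-+ K (n ∸ K) g ⟩
    ∑ K g + ∑ (n ∸ K) (λ e → g (K ℕ.+ e))  ≡⟨ cong (_+_ (∑ K g)) (∑-zero (n ∸ K) (λ e _ → empty-beyond e)) ⟩
    ∑ K g + 0ℤ                             ≡⟨ +-identityʳ _ ⟩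
    ∑ K g                                  ≡⟨ ∑-layout q (λ d s → G (Maybe.map (realise d) s) d) ⟩
    ∑ q (λ t → blockSum G (t ℕ.* 4)) + finalSum G (q ℕ.* 4)
      ∎
    where
    open ≡-Reasoning
    K = q ℕ.* 4 ℕ.+ 7
    g : ℕ → ℤ
    g d = G (diagonals d) d
    empty-beyond : ∀ e → g (K ℕ.+ e) ≡ 0ℤ
    empty-beyond e rewrite layout-beyond q e = G-nothing (K ℕ.+ e)

  block-offsets : ∀ b → blockSum (λ m _ → offsetTerm m) b ≡ 0ℤ
  block-offsets b = cancel (layer-+ b 0) (layer-+ b 1) (layer-+ b 2) (layer-+ b 3)
    where
    B = + b
    N = + n
    cancel : ∀ {L₀ L₁ L₂ L₃} →
      L₀ ≡ 1ℤ + (B + + 0) * N → L₁ ≡ 1ℤ + (B + + 1) * N →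
      L₂ ≡ 1ℤ + (B + + 2) * N → L₃ ≡ 1ℤ + (B + + 3) * N →
      L₀ + (- L₁ + (- L₂ + (L₃ + 0ℤ))) ≡ 0ℤ
    cancel refl refl refl refl = lemma B N
      where
      lemma : ∀ B N → 1ℤ + (B + + 0) * N + (- (1ℤ + (B + + 1) * N) +
                (- (1ℤ + (B + + 2) * N) + (1ℤ + (B + + 3) * N + 0ℤ))) ≡ 0ℤ
      lemma = solve-∀

  final-offsets : ∀ b → finalSum (λ m _ → offsetTerm m) b ≡ - (+ 2 * + n * (+ b + + 6) + 1ℤ)
  final-offsets b =
    total (layer-+ b 0) (layer-+ b 1) (layer-+ b 2) (layer-+ b 3) (layer-+ b 4) (layer-+ b 6)
    where
    B = + b
    N = + n
    total : ∀ {L₀ L₁ L₂ L₃ L₄ L₆} →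
      L₀ ≡ 1ℤ + (B + + 0) * N → L₁ ≡ 1ℤ + (B + + 1) * N → L₂ ≡ 1ℤ + (B + + 2) * N →
      L₃ ≡ 1ℤ + (B + + 3) * N → L₄ ≡ 1ℤ + (B + + 4) * N → L₆ ≡ 1ℤ + (B + + 6) * N →
      L₀ + (- L₁ + (L₂ + (- L₃ + (- L₄ + (0ℤ + ((1ℤ - L₆) + 0ℤ)))))) ≡ - (+ 2 * N * (B + + 6) + 1ℤ)
    total refl refl refl refl refl refl = lemma B N
      where
      lemma : ∀ B N → 1ℤ + (B + + 0) * N + (- (1ℤ + (B + + 1) * N) + (1ℤ + (B + + 2) * N +
                (- (1ℤ + (B + + 3) * N) + (- (1ℤ + (B + + 4) * N) +
                (0ℤ + ((1ℤ - (1ℤ + (B + + 6) * N)) + 0ℤ)))))) ≡ - (+ 2 * N * (B + + 6) + 1ℤ)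
      lemma = solve-∀

  module _ (k<n : q ℕ.* 4 ℕ.+ 6 < n) where

    bound : q ℕ.* 4 ℕ.+ 7 ≤ n
    bound = subst (_≤ n) (sym (ℕ.+-suc (q ℕ.* 4) 6)) k<n

    filled-count : ∑ n (indicator ∘ diagonals) ≡ + (q ℕ.* 4 ℕ.+ 6)
    filled-count = begin
      ∑ n (indicator ∘ diagonals)  ≡⟨ ∑-diagonals (λ m _ → indicator m) (λ _ → refl) bound ⟩
      ∑ q (λ _ → + 4) + + 6        ≡⟨ cong (_+ + 6) (∑-const q (+ 4)) ⟩
      + q * + 4 + + 6              ≡⟨ cong (_+ + 6) (pos-* q 4) ⟨
      + (q ℕ.* 4) + + 6            ≡⟨ pos-+ (q ℕ.* 4) 6 ⟨
      + (q ℕ.* 4 ℕ.+ 6)            ∎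
      where open ≡-Reasoning

    row-phases : ∀ i → ∑ n (λ d → phaseTerm (diagonals d) i) ≡ 0ℤ
    row-phases i = begin
      ∑ n (λ d → phaseTerm (diagonals d) i)                    ≡⟨ ∑-diagonals G (λ _ → refl) bound ⟩
      ∑ q (λ t → blockSum G (t ℕ.* 4)) + finalSum G (q ℕ.* 4)
        ≡⟨ cong₂ _+_ (∑-zero q (λ _ _ → blockCancels (+ (i ⊕ 0)) (+ (i ⊕ 2))))
                     (finalCancels (+ (i ⊕ 0)) (+ (i ⊕ 1)) (+ (i ⊕ 4))) ⟩
      0ℤ                                                       ∎
      where
      open ≡-Reasoning
      G : Maybe Diagonal → ℕ → ℤ
      G m _ = phaseTerm m i
      blockCancels : ∀ a b → 1ℤ * a + (- 1ℤ * a + (- 1ℤ * b + (1ℤ * b + 0ℤ))) ≡ 0ℤ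
      blockCancels = solve-∀
      finalCancels : ∀ a b c →
        1ℤ * a + (- 1ℤ * a + (1ℤ * b + (- 1ℤ * b + (- 1ℤ * c + (0ℤ + (1ℤ * c + 0ℤ)))))) ≡ 0ℤ
      finalCancels = solve-∀

    block-bound : ∀ {t r} → t < q → r ≤ 4 → t ℕ.* 4 ℕ.+ r ≤ n
    block-bound {t} {r} t<q r≤4 = ℕ.≤-trans (ℕ.+-monoʳ-≤ (t ℕ.* 4) r≤4) (ℕ.≤-trans
      (ℕ.≤-reflexive (ℕ.+-comm (t ℕ.* 4) 4))
      (ℕ.≤-trans (ℕ.*-monoˡ-≤ 4 t<q) (ℕ.≤-trans (ℕ.m≤m+n (q ℕ.* 4) 7) bound)))

    final-bound : ∀ {r} → r ≤ 7 → q ℕ.* 4 ℕ.+ r ≤ n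
    final-bound r≤7 = ℕ.≤-trans (ℕ.+-monoʳ-≤ (q ℕ.* 4) r≤7) bound

    column-phase-cong : ∀ j b {r₁ r₂ γ₁ γ₂} →
      b ℕ.+ r₁ ≤ n → b ℕ.+ r₂ ≤ n → r₁ ℕ.+ γ₂ ≡ r₂ ℕ.+ γ₁ →
      + ((j ⊖ (b ℕ.+ r₁)) ⊕ γ₁) ≡ + ((j ⊖ (b ℕ.+ r₂)) ⊕ γ₂)
    column-phase-cong j b {r₁} {r₂} {γ₁} {γ₂} ≤n₁ ≤n₂ eq =
      cong +_ ([x⊖d₁]⊕γ₁≡[x⊖d₂]⊕γ₂ j ≤n₁ ≤n₂ (begin
      b ℕ.+ r₁ ℕ.+ γ₂    ≡⟨ ℕ.+-assoc b r₁ γ₂ ⟩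
      b ℕ.+ (r₁ ℕ.+ γ₂)  ≡⟨ cong (b ℕ.+_) eq ⟩
      b ℕ.+ (r₂ ℕ.+ γ₁)  ≡⟨ ℕ.+-assoc b r₂ γ₁ ⟨
      b ℕ.+ r₂ ℕ.+ γ₁    ∎))
      where open ≡-Reasoning

    -- Along a column, diagonal b + r with shift γ has a phase depending only on γ − r: this
    -- pairs r = 0, 2 and r = 1, 3 in a block, and r = 1, 2 and 0, 4 and 3, 6 in the final seven.
    col-phases : ∀ j → ∑ n (λ d → phaseTerm (diagonals d) (j ⊖ d)) ≡ 0ℤ
    col-phases j = begin
      ∑ n (λ d → phaseTerm (diagonals d) (j ⊖ d))      ≡⟨ ∑-diagonals G (λ _ → refl) bound ⟩
      ∑ q (λ t → blockSum G (t ℕ.* 4)) + finalSum G A  ≡⟨ cong₂ _+_ (∑-zero q blockCancels) finalCancels ⟩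
      0ℤ                                               ∎
      where
      open ≡-Reasoning
      G : Maybe Diagonal → ℕ → ℤ
      G m d = phaseTerm m (j ⊖ d)
      A = q ℕ.* 4
      cancel₄ : ∀ a b {c d} → c ≡ a → d ≡ b → 1ℤ * a + (- 1ℤ * b + (- 1ℤ * c + (1ℤ * d + 0ℤ))) ≡ 0ℤ
      cancel₄ a b refl refl = lemma a b
        where
        lemma : ∀ a b → 1ℤ * a + (- 1ℤ * b + (- 1ℤ * a + (1ℤ * b + 0ℤ))) ≡ 0ℤ
        lemma = solve-∀
      blockCancels : ∀ t → t < q → blockSum G (t ℕ.* 4) ≡ 0ℤ
      blockCancels t t<q = cancel₄ _ _
        (column-phase-cong j (t ℕ.* 4) (block-bound t<q (ℕ.m≤m+n 2 2)) (block-bound t<q z≤n) refl)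
        (column-phase-cong j (t ℕ.* 4) (block-bound t<q (ℕ.m≤m+n 3 1)) (block-bound t<q (ℕ.m≤m+n 1 3)) refl)
      cancel₆ : ∀ a b c {a′ b′ c′} → b′ ≡ b → a′ ≡ a → c′ ≡ c →
        1ℤ * a + (- 1ℤ * b + (1ℤ * b′ + (- 1ℤ * c + (- 1ℤ * a′ + (0ℤ + (1ℤ * c′ + 0ℤ)))))) ≡ 0ℤ
      cancel₆ a b c refl refl refl = lemma a b c
        where
        lemma : ∀ a b c →
          1ℤ * a + (- 1ℤ * b + (1ℤ * b + (- 1ℤ * c + (- 1ℤ * a + (0ℤ + (1ℤ * c + 0ℤ)))))) ≡ 0ℤ
        lemma = solve-∀
      finalCancels : finalSum G A ≡ 0ℤ
      finalCancels = cancel₆ _ _ _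
        (column-phase-cong j A (final-bound (ℕ.m≤m+n 2 5)) (final-bound (ℕ.m≤m+n 1 6)) refl)
        (column-phase-cong j A (final-bound (ℕ.m≤m+n 4 3)) (final-bound z≤n) refl)
        (column-phase-cong j A (final-bound (ℕ.m≤m+n 6 1)) (final-bound (ℕ.m≤m+n 3 4)) refl)

    offset-sum : ∑ n (offsetTerm ∘ diagonals) ≡ - + (2 ℕ.* n ℕ.* (q ℕ.* 4 ℕ.+ 6) ℕ.+ 1)
    offset-sum = begin
      ∑ n (offsetTerm ∘ diagonals)                      ≡⟨ ∑-diagonals G (λ _ → refl) bound ⟩
      ∑ q (λ t → blockSum G (t ℕ.* 4)) + finalSum G A   ≡⟨ cong₂ _+_ (∑-zero q (λ t _ → block-offsets (t ℕ.* 4)))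
                                                                     (final-offsets A) ⟩
      0ℤ + - (+ 2 * + n * (+ A + + 6) + 1ℤ)  ≡⟨ +-identityˡ _ ⟩
      - (+ 2 * + n * (+ A + + 6) + 1ℤ)       ≡⟨ cong -_ modulus ⟨
      - + (2 ℕ.* n ℕ.* (A ℕ.+ 6) ℕ.+ 1)      ∎
      where
      open ≡-Reasoning
      G : Maybe Diagonal → ℕ → ℤ
      G m _ = offsetTerm m
      A = q ℕ.* 4
      modulus : + (2 ℕ.* n ℕ.* (A ℕ.+ 6) ℕ.+ 1) ≡ + 2 * + n * (+ A + + 6) + 1ℤ
      modulus = begin
        + (2 ℕ.* n ℕ.* (A ℕ.+ 6) ℕ.+ 1)  ≡⟨ pos-+ (2 ℕ.* n ℕ.* (A ℕ.+ 6)) 1 ⟩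
        + (2 ℕ.* n ℕ.* (A ℕ.+ 6)) + 1ℤ   ≡⟨ cong (_+ 1ℤ) (pos-* (2 ℕ.* n) (A ℕ.+ 6)) ⟩
        + (2 ℕ.* n) * + (A ℕ.+ 6) + 1ℤ   ≡⟨ cong₂ (λ x y → x * y + 1ℤ) (pos-* 2 n) (pos-+ A 6) ⟩
        + 2 * + n * (+ A + + 6) + 1ℤ     ∎

    signed-value : ∀ {c} ρ → Signed (layout q c) →
      ∃ λ δ → diagonals c ≡ just δ × value δ ρ ≡± suc (ρ ℕ.+ c ℕ.* n)
    signed-value {c} ρ = signed
      where
      layer-value : + ρ + layer c ≡ + suc (ρ ℕ.+ c ℕ.* n)
      layer-value = cong +_ (ℕ.+-suc ρ (c ℕ.* n))
      negate : ∀ a b → - 1ℤ * a + - b ≡ - (a + b)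
      negate = solve-∀
      signed : ∀ {s} → Signed s →
        ∃ λ δ → Maybe.map (realise c) s ≡ just δ × value δ ρ ≡± suc (ρ ℕ.+ c ℕ.* n)
      signed (positive γ) = _ , refl , inj₁ (trans (cong (_+ layer c) (*-identityˡ (+ ρ))) layer-value)
      signed (negative γ) = _ , refl , inj₂ (trans (negate (+ ρ) (layer c)) (cong -_ layer-value))

    top-value : ∀ {c} ρ → ρ < n → value (realise (suc c) (dec , 4)) (n ∸ suc ρ) ≡ - + suc (ρ ℕ.+ c ℕ.* n)
    top-value {c} ρ ρ<n = begin
      1ℤ * + p + (1ℤ - + suc (n ℕ.+ m))
        ≡⟨ cong (λ z → 1ℤ * + p + (1ℤ - + suc (z ℕ.+ m))) (ℕ.m∸n+n≡m ρ<n) ⟨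
      1ℤ * + p + (1ℤ - + suc (p ℕ.+ suc ρ ℕ.+ m))
        ≡⟨ cancel (+ p) (+ ρ) (+ m) ⟩
      - + suc (ρ ℕ.+ m)
        ∎
      where
      open ≡-Reasoning
      p = n ∸ suc ρ
      m = c ℕ.* n
      cancel : ∀ P R M → 1ℤ * P + (1ℤ - (1ℤ + (P + (1ℤ + R) + M))) ≡ - (1ℤ + (R + M))
      cancel = solve-∀

    occurs-in-layer : ∀ {ρ c} → ρ < n → c < q ℕ.* 4 ℕ.+ 6 → Occurs (suc (ρ ℕ.+ c ℕ.* n))
    occurs-in-layer {ρ} {c} ρ<n c<k with c ℕ.<? q ℕ.* 4 ℕ.+ 5
    ... | yes c<A+5 with signed-value ρ (layout-signed q c c<A+5)
    ...   | δ , eq , ±x = c , ρ , δ , c<n , ρ<n , eq , ±x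
      where
      c<n : c < n
      c<n = ℕ.<-trans c<A+5 (ℕ.<-trans (ℕ.+-monoʳ-< (q ℕ.* 4) (ℕ.n<1+n 5)) k<n)
    occurs-in-layer {ρ} {c} ρ<n c<k | no c≮A+5 =
      suc c , n ∸ suc ρ , _ , top<n , ℕ.∸-monoʳ-< ℕ.z<s ρ<n ,
      cong (Maybe.map (realise (suc c))) top-layout , inj₂ (top-value {c} ρ ρ<n)
      where
      c≡A+5 : c ≡ q ℕ.* 4 ℕ.+ 5
      c≡A+5 = ℕ.≤-antisym (ℕ.≤-pred (subst (c <_) (ℕ.+-suc (q ℕ.* 4) 5) c<k)) (ℕ.≮⇒≥ c≮A+5)
      top<n : suc c < n
      top<n = subst (_< n) (trans (ℕ.+-suc (q ℕ.* 4) 5) (cong suc (sym c≡A+5))) k<n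
      top-layout : layout q (suc c) ≡ just (dec , 4)
      top-layout = trans (cong (layout q ∘ suc) c≡A+5) (layout-dec q)

    support : ∀ x → 1 ≤ x → x ≤ n ℕ.* (q ℕ.* 4 ℕ.+ 6) → Occurs x
    support (suc y) _ y<nk = subst Occurs (cong suc (sym (m≡m%n+[m/n]*n y n)))
      (occurs-in-layer (m%n<n y n) (m<n*o⇒m/o<n (subst (y <_) (ℕ.*-comm n (q ℕ.* 4 ℕ.+ 6)) y<nk)))

    cyclic-isHeffter : IsHeffter n (q ℕ.* 4 ℕ.+ 6) array
    cyclic-isHeffter =
      isHeffter (q ℕ.* 4 ℕ.+ 6) filled-count row-phases col-phases (∣-negation offset-sum) support

k≡4q+6 : ∀ {k} → k % 4 ≡ 2 → 6 ≤ k → ∃ λ q → q ℕ.* 4 ℕ.+ 6 ≡ k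
k≡4q+6 {k} k%4≡2 6≤k = split (k / 4) (trans (m≡m%n+[m/n]*n k 4) (cong (ℕ._+ (k / 4 ℕ.* 4)) k%4≡2))
  where
  split : ∀ w → k ≡ 2 ℕ.+ w ℕ.* 4 → ∃ λ q → q ℕ.* 4 ℕ.+ 6 ≡ k
  split zero    k≡2   = contradiction (subst (6 ≤_) k≡2 6≤k) λ { (s≤s (s≤s ())) }
  split (suc q) k≡6+q = q , trans (ℕ.+-comm (q ℕ.* 4) 6) (sym k≡6+q)

-- The construction works for every n > k.
theorem3p2 : (n k : ℕ) → (n % 4 ≡ 1 ⊎ n % 4 ≡ 3) → k % 4 ≡ 2 →
             k < n → 6 ≤ k → HeffterArray n k
theorem3p2 zero      k _ _      ()  _
theorem3p2 n@(suc _) k _ k%4≡2 k<n 6≤k with k≡4q+6 k%4≡2 6≤k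
... | q , refl = array , cyclic-isHeffter k<n
  where open CyclicConstruction n q
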